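{- Let $\mathcal{X}$ be a finite proper $n$-edge-coloured graph with colour set $I=\{0,\dots,n-1\}$. For $i\in I$ let $\rho_i$ be the permutation of the vertices of $\mathcal{X}$ induced by the edges of colour $i$, let $G=\langle\rho_i:i\in I\rangle$, and for $i,j\in I$ let $G_i=\langle\rho_k:k\in I\setminus\{i\}\rangle$ and $G_{i,j}=\langle\rho_k:k\in I\setminus\{i,j\}\rangle$. Assume that for every $i\in I$ the group $G_i$ is flag-transitive on the incidence system $\Gamma(G_i;(G_{i,j})_{j\in I\setminus\{i\}})$. Let $i,j,k\in I$ be distinct. If for some vertex $x$ of $\mathcal{X}$ $$|xG_i\cap x(G_jG_k)|\cdot|\mathrm{Stab}_{G_i}(x)|\le|(G_i\cap G_j)(G_i\cap G_k)|,$$ then $G$ acts transitively on the set of flags of type $\{i,j,k\}$ of $\Gamma(G;(G_i)_{i\in I})$.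
   Context: A proper $n$-edge-coloured graph is a (multi)graph whose edges are coloured with colours in $I$ such that, for each $i\in I$, the edges of colour $i$ form a non-empty matching $M_i$, and $M_i\ne M_j$ for $i\ne j$; $\rho_i$ swaps the endpoints of each edge of $M_i$ and fixes all other vertices. $xH$ is the orbit of vertex $x$ under a set/group $H$ of permutations (so $x(G_jG_k)=\{x\alpha\beta:\alpha\in G_j,\beta\in G_k\}$), and $\mathrm{Stab}_H(x)$ the stabiliser; $AB=\{ab:a\in A,b\in B\}$. For a group $H$ with subgroups $(H_j)_{j\in J}$, the incidence system $\Gamma(H;(H_j)_{j\in J})$ has as elements the right cosets $H_jg$ ($g\in H$, $j\in J$), the type of $H_jg$ is $j$, and $H_jg\ast H_{j'}g'$ iff $H_jg\cap H_{j'}g'\neq\emptyset$; $H$ acts on it by right multiplication. A flag is a set of pairwise incident elements, its type the set of types of its elements; $H$ is flag-transitive on $\Gamma$ if for each type set it is transitive on the flags of that type. -}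

module Defs where

open import Data.Nat using (ℕ)
open import Data.Fin using (Fin)
open import Data.Fin.Subset using (Subset; _∈_; _⊆_; ⁅_⁆; ∁; _∪_; ⊤)
open import Data.List using (List; []; _∷_)
open import Data.List.Relation.Unary.All using (All)
open import Data.Product using (Σ; ∃; _×_)
open import Relation.Binary.PropositionalEquality using (_≡_; _≢_)
open import Relation.Nullary using (¬_)

-- Maps on the vertex set Fin m; permutations act on the RIGHT:
-- x (f · g) = (x f) g, written here as (f · g) x = g (f x).
Perm : ℕ → Set
Perm m = Fin m → Fin m

_≈_ : ∀ {m} → Perm m → Perm m → Set
f ≈ g = ∀ x → f x ≡ g x

_·_ : ∀ {m} → Perm m → Perm m → Perm m
(f · g) x = g (f x)

-- The matching M_i of colour i is encoded by the
-- involution ρ i (ρ i x is the partner of x along its i-edge, or x itself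
-- if x is not covered by M_i); edges of colour i are the pairs {x, ρ i x}
-- with ρ i x ≢ x.
record ColouredGraph (n m : ℕ) : Set where
  field
    ρ        : Fin n → Perm m
    invol    : ∀ i x → ρ i (ρ i x) ≡ x
    nonEmpty : ∀ i → ∃ λ x → ρ i x ≢ x
    distinct : ∀ i j → i ≢ j → ¬ (∀ x → ρ i x ≡ ρ j x)

HasSize : ∀ {A : Set} → (A → A → Set) → (A → Set) → ℕ → Set
HasSize {A} _~_ P c =
  Σ (Fin c → A) λ e →
    (∀ k k' → e k ~ e k' → k ≡ k') ×
    (∀ k → P (e k)) ×
    (∀ a → P a → ∃ λ k → a ~ e k)

module _ {m : ℕ} where

  InCoset : (Perm m → Set) → Perm m → Perm m → Set
  InCoset K g f = ∃ λ h → K h × f ≈ (h · g)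

  SameCoset : (Perm m → Set) → Perm m → Perm m → Set
  SameCoset K g g' = ∀ f → (InCoset K g f → InCoset K g' f) × (InCoset K g' f → InCoset K g f)

  Incident : (Perm m → Set) → Perm m → (Perm m → Set) → Perm m → Set
  Incident K g K' g' = ∃ λ f → InCoset K g f × InCoset K' g' f

  record Flag {n : ℕ} (H : Perm m → Set) (Hs : Fin n → Perm m → Set) (T : Subset n) : Set where
    field
      rep  : ∀ t → t ∈ T → Perm m
      rep∈ : ∀ t (p : t ∈ T) → H (rep t p)
      inc  : ∀ t (p : t ∈ T) t' (p' : t' ∈ T) → Incident (Hs t) (rep t p) (Hs t') (rep t' p')

  open Flag public

  FlagTransitiveOn : ∀ {n} → (Perm m → Set) → (Fin n → Perm m → Set) → Subset n → Set
  FlagTransitiveOn H Hs T = ∀ (F F' : Flag H Hs T) →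
    ∃ λ h → H h × (∀ t (p : t ∈ T) → SameCoset (Hs t) (rep F t p · h) (rep F' t p))

  FlagTransitive : ∀ {n} → (Perm m → Set) → (Fin n → Perm m → Set) → Subset n → Set
  FlagTransitive H Hs J = ∀ T → T ⊆ J → FlagTransitiveOn H Hs T

module _ {n m : ℕ} (X : ColouredGraph n m) where
  open ColouredGraph X

  evalW : List (Fin n) → Perm m
  evalW [] x = x
  evalW (i ∷ w) x = evalW w (ρ i x)

  -- ⟨ρ_k : k ∈ J⟩ : since each ρ_k is an involution, its elements are
  -- exactly the finite products of generators.
  Gen : Subset n → Perm m → Set
  Gen J f = ∃ λ w → All (_∈ J) w × f ≈ evalW w

  G : Perm m → Set
  G = Gen ⊤

  G₁ : Fin n → Perm m → Set
  G₁ i = Gen (∁ ⁅ i ⁆)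

  G₂ : Fin n → Fin n → Perm m → Set
  G₂ i j = Gen (∁ (⁅ i ⁆ ∪ ⁅ j ⁆))

  OrbitMeet : Fin n → Fin n → Fin n → Fin m → Fin m → Set
  OrbitMeet i j k x y =
    (∃ λ g → G₁ i g × g x ≡ y) ×
    (∃ λ a → ∃ λ b → G₁ j a × G₁ k b × (a · b) x ≡ y)

  Stab : Fin n → Fin m → Perm m → Set
  Stab i x g = G₁ i g × g x ≡ x

  ProdInter : Fin n → Fin n → Fin n → Perm m → Set
  ProdInter i j k f =
    ∃ λ a → ∃ λ b → (G₁ i a × G₁ j a) × (G₁ i b × G₁ k b) × f ≈ (a · b)

-- G is transitive on flags of type {i,j,k} as soon as G_i ∩ G_j G_k ⊆ (G_i ∩ G_j)(G_i ∩ G_k).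
-- Indeed, a flag can first be moved so that its elements of types i and j become G_i and G_j;
-- its element G_k q of type k then meets both, giving w q ∈ G_i and w' q ∈ G_j with
-- w, w' ∈ G_k. Now (w q)⁻¹ = (w' q)⁻¹ w' w⁻¹ lies in G_i ∩ G_j G_k, and a factorisation
-- (w q)⁻¹ = d e with d ∈ G_i ∩ G_j, e ∈ G_i ∩ G_k gives q d = w⁻¹ e⁻¹ ∈ G_k, so moving the
-- flag further by d fixes G_i and G_j and carries G_k q to G_k.
-- The inclusion comes from counting: g ↦ (x g, g t⁻¹), where t ∈ G_i is a fixed element taking
-- x to x g, embeds G_i ∩ G_j G_k into (x G_i ∩ x (G_j G_k)) × Stab_{G_i}(x). By hypothesis the
-- latter has at most |(G_i ∩ G_j)(G_i ∩ G_k)| elements, and (G_i ∩ G_j)(G_i ∩ G_k) is contained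
-- in G_i ∩ G_j G_k, so the two sets coincide.
module Submission where

open import Defs
open import Data.Nat using (ℕ; suc; _*_; _≤_)
open import Data.Nat.Properties using (<⇒≱)
open import Data.Fin using (Fin; zero; suc; combine; _≟_)
open import Data.Fin.Properties using (any?; combine-injective; injective⇒≤)
open import Data.Fin.Subset using (Subset; _∈_; _⊆_; ⊤; ⁅_⁆; ∁; _∪_)
open import Data.Fin.Subset.Properties using (∈⊤; x∈⁅x⁆; x∈⁅y⁆⇒x≡y; x∈p∪q⁺; x∈p∪q⁻)
open import Data.List using (List; []; _∷_; _++_; reverse)
open import Data.List.Properties using (unfold-reverse; reverse-involutive)
open import Data.List.Relation.Unary.All as All using (All)
open import Data.List.Relation.Unary.All.Properties using (++⁺)
open import Data.Product using (∃; _×_; _,_; proj₁; proj₂)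
open import Data.Sum using (_⊎_; inj₁; inj₂)
open import Function using (id)
open import Relation.Binary.PropositionalEquality
  using (_≡_; _≢_; refl; sym; trans; cong; subst; _→-setoid_; module ≡-Reasoning)
open import Relation.Nullary using (yes; no)
open import Relation.Nullary.Negation using (contradiction)
import Relation.Binary.Reasoning.Setoid as SetoidReasoning

module ≈-Reasoning {m : ℕ} = SetoidReasoning (Fin m →-setoid Fin m)

module _ {m : ℕ} where

  ≈-refl : {f : Perm m} → f ≈ f
  ≈-refl x = refl

  ≈-sym : {f g : Perm m} → f ≈ g → g ≈ f
  ≈-sym f≈g x = sym (f≈g x)

  ≈-trans : {f g h : Perm m} → f ≈ g → g ≈ h → f ≈ h
  ≈-trans f≈g g≈h x = trans (f≈g x) (g≈h x)

  ·-congˡ : {f f' : Perm m} (g : Perm m) → f ≈ f' → (f · g) ≈ (f' · g)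
  ·-congˡ g f≈f' x = cong g (f≈f' x)

  ·-congʳ : (f : Perm m) {g g' : Perm m} → g ≈ g' → (f · g) ≈ (f · g')
  ·-congʳ f g≈g' x = g≈g' (f x)

  -- The inverse is computed from a membership proof; inverses obtained from different
  -- proofs or different subgroups agree only up to ≈.
  record IsSubgroup (K : Perm m → Set) : Set where
    field
      ∈-resp-≈ : ∀ {f g} → f ≈ g → K f → K g
      id-∈     : K id
      ·-∈      : ∀ {f g} → K f → K g → K (f · g)
      inv      : ∀ {f} → K f → Perm m
      inv-∈    : ∀ {f} (p : K f) → K (inv p)
      inverseˡ : ∀ {f} (p : K f) → (inv p · f) ≈ id
      inverseʳ : ∀ {f} (p : K f) → (f · inv p) ≈ id

  open IsSubgroup public

  module _ {K : Perm m → Set} (K-sub : IsSubgroup K) where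

    ∈-if-≈-id : ∀ {f} → f ≈ id → K f
    ∈-if-≈-id f≈id = ∈-resp-≈ K-sub (≈-sym f≈id) (id-∈ K-sub)

    ∈-cancelˡ : ∀ {u g} → K u → K (u · g) → K g
    ∈-cancelˡ {g = g} Ku Kug =
      ∈-resp-≈ K-sub (·-congˡ g (inverseˡ K-sub Ku)) (·-∈ K-sub (inv-∈ K-sub Ku) Kug)

    inverse-unique : ∀ {α y} (p : K α) → (y · α) ≈ id → y ≈ inv K-sub p
    inverse-unique {α} {y} p yα≈id = begin
      y                     ≈˘⟨ ·-congʳ y (inverseʳ K-sub p) ⟩
      (y · α) · inv K-sub p ≈⟨ ·-congˡ (inv K-sub p) yα≈id ⟩
      inv K-sub p           ∎
      where open ≈-Reasoning

    sameCoset : ∀ {δ g g'} → K δ → g ≈ (δ · g') → SameCoset K g g'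
    sameCoset {δ} {g} {g'} Kδ g≈δg' f = to , from
      where
      to : InCoset K g f → InCoset K g' f
      to (γ , Kγ , f≈γg) = γ · δ , ·-∈ K-sub Kγ Kδ , ≈-trans f≈γg (·-congʳ γ g≈δg')

      from : InCoset K g' f → InCoset K g f
      from (γ , Kγ , f≈γg') = γ · inv K-sub Kδ , ·-∈ K-sub Kγ (inv-∈ K-sub Kδ) , (begin
        f                             ≈⟨ f≈γg' ⟩
        γ · g'                        ≈˘⟨ ·-congʳ γ (·-congˡ g' (inverseˡ K-sub Kδ)) ⟩
        γ · ((inv K-sub Kδ · δ) · g') ≈˘⟨ ·-congʳ (γ · inv K-sub Kδ) g≈δg' ⟩
        (γ · inv K-sub Kδ) · g        ∎)
        where open ≈-Reasoning

  module _ {K K' : Perm m → Set} where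

    incident⇒≈ : ∀ {g g'} → Incident K g K' g' →
                 ∃ λ u → ∃ λ v → K u × K' v × (u · g) ≈ (v · g')
    incident⇒≈ (f , (u , Ku , f≈ug) , (v , K'v , f≈vg')) =
      u , v , Ku , K'v , ≈-trans (≈-sym f≈ug) f≈vg'

    incident-meets-subgroup : IsSubgroup K' → ∀ {g g'} h → Incident K g K' g' →
                              K' (g' · h) → ∃ λ u → K u × K' ((u · g) · h)
    incident-meets-subgroup K'-sub {g} {g'} h inc K'g'h with incident⇒≈ {g = g} {g'} inc
    ... | u , v , Ku , K'v , ug≈vg' =
      u , Ku , ∈-resp-≈ K'-sub (≈-sym (·-congˡ h ug≈vg')) (·-∈ K'-sub K'v K'g'h)

  incident-same-type : ∀ {K} → IsSubgroup K → ∀ {g g'} h → Incident K g K g' →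
                       K (g' · h) → K (g · h)
  incident-same-type K-sub {g} {g'} h inc Kg'h
    with incident-meets-subgroup K-sub {g = g} {g'} h inc Kg'h
  ... | u , Ku , Kugh = ∈-cancelˡ K-sub Ku Kugh

Factorises : ∀ {m} → (A B C : Perm m → Set) → Set
Factorises A B C = ∀ {g} → A g → (∃ λ b → ∃ λ c → B b × C c × g ≈ (b · c)) →
  ∃ λ d → ∃ λ e → (A d × B d) × (A e × C e) × g ≈ (d · e)

factorises-closes-triangle : ∀ {m} {A B C : Perm m → Set} →
  IsSubgroup A → IsSubgroup B → IsSubgroup C → Factorises A B C →
  ∀ {q w w'} → C w → A (w · q) → C w' → B (w' · q) → ∃ λ d → (A d × B d) × C (q · d)
factorises-closes-triangle A-sub B-sub C-sub factorises {q} {w} {w'} Cw Awq Cw' Bw'q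
  with factorises (inv-∈ A-sub Awq)
         (inv B-sub Bw'q , w' · inv C-sub Cw , inv-∈ B-sub Bw'q , ·-∈ C-sub Cw' (inv-∈ C-sub Cw) ,
          ≈-sym (inverse-unique A-sub Awq βww⁻¹α≈id))
  where
  open ≈-Reasoning
  βww⁻¹α≈id : ((inv B-sub Bw'q · (w' · inv C-sub Cw)) · (w · q)) ≈ id
  βww⁻¹α≈id = begin
    (inv B-sub Bw'q · (w' · inv C-sub Cw)) · (w · q)
      ≈⟨ ·-congʳ (inv B-sub Bw'q · w') (·-congˡ q (inverseˡ C-sub Cw)) ⟩
    inv B-sub Bw'q · (w' · q)
      ≈⟨ inverseˡ B-sub Bw'q ⟩
    id ∎
... | d , e , (Ad , Bd) , (_ , Ce) , α⁻¹≈de =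
  d , (Ad , Bd) , ∈-cancelˡ C-sub Cw (∈-resp-≈ C-sub (≈-sym wqd≈e⁻¹) (inv-∈ C-sub Ce))
  where
  wqd≈e⁻¹ : ((w · q) · d) ≈ inv C-sub Ce
  wqd≈e⁻¹ = inverse-unique C-sub Ce
    (≈-trans (·-congʳ (w · q) (≈-sym α⁻¹≈de)) (inverseʳ A-sub Awq))

module _ {n : ℕ} {i j k : Fin n} where

  ∈-triple₁ : i ∈ ⁅ i ⁆ ∪ ⁅ j ⁆ ∪ ⁅ k ⁆
  ∈-triple₁ = x∈p∪q⁺ (inj₁ (x∈⁅x⁆ i))

  ∈-triple₂ : j ∈ ⁅ i ⁆ ∪ ⁅ j ⁆ ∪ ⁅ k ⁆
  ∈-triple₂ = x∈p∪q⁺ {p = ⁅ i ⁆} (inj₂ (x∈p∪q⁺ (inj₁ (x∈⁅x⁆ j))))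

  ∈-triple₃ : k ∈ ⁅ i ⁆ ∪ ⁅ j ⁆ ∪ ⁅ k ⁆
  ∈-triple₃ = x∈p∪q⁺ {p = ⁅ i ⁆} (inj₂ (x∈p∪q⁺ {p = ⁅ j ⁆} (inj₂ (x∈⁅x⁆ k))))

  ∈-triple⁻ : ∀ {t} → t ∈ ⁅ i ⁆ ∪ ⁅ j ⁆ ∪ ⁅ k ⁆ → t ≡ i ⊎ t ≡ j ⊎ t ≡ k
  ∈-triple⁻ t∈ with x∈p∪q⁻ ⁅ i ⁆ (⁅ j ⁆ ∪ ⁅ k ⁆) t∈
  ... | inj₁ t∈i = inj₁ (x∈⁅y⁆⇒x≡y i t∈i)
  ... | inj₂ t∈jk with x∈p∪q⁻ ⁅ j ⁆ ⁅ k ⁆ t∈jk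
  ... | inj₁ t∈j = inj₂ (inj₁ (x∈⁅y⁆⇒x≡y j t∈j))
  ... | inj₂ t∈k = inj₂ (inj₂ (x∈⁅y⁆⇒x≡y k t∈k))

module _ {m n : ℕ} {H : Perm m → Set} {Hs : Fin n → Perm m → Set}
         (H-sub : IsSubgroup H) (Hs-sub : ∀ t → IsSubgroup (Hs t))
         (Hs⊆H : ∀ t {f} → Hs t f → H f) where

  CarriesToBase : ∀ {T} → Flag H Hs T → Perm m → Set
  CarriesToBase {T} F h = ∀ t (p : t ∈ T) → Hs t (rep F t p · h)

  flag-same-type : ∀ {T} (F : Flag H Hs T) t (p p' : t ∈ T) h →
                   Hs t (rep F t p' · h) → Hs t (rep F t p · h)
  flag-same-type F t p p' h =
    incident-same-type (Hs-sub t) {rep F t p} {rep F t p'} h (inc F t p t p')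

  flag-meets-subgroup : ∀ {T} (F : Flag H Hs T) t (p : t ∈ T) t' (p' : t' ∈ T) h →
                        Hs t' (rep F t' p' · h) → ∃ λ u → Hs t u × Hs t' ((u · rep F t p) · h)
  flag-meets-subgroup F t p t' p' h =
    incident-meets-subgroup (Hs-sub t') {rep F t p} {rep F t' p'} h (inc F t p t' p')

  flagTransitiveOn-if-carried : ∀ {T} → (∀ F → ∃ λ h → H h × CarriesToBase F h) →
                                FlagTransitiveOn H Hs T
  flagTransitiveOn-if-carried carry F F' with carry F | carry F'
  ... | h , Hh , F↦ | h' , Hh' , F'↦ =
    h · inv H-sub Hh' , ·-∈ H-sub Hh (inv-∈ H-sub Hh') , sameCosets
    where
    sameCosets : ∀ t p → SameCoset (Hs t) (rep F t p · (h · inv H-sub Hh')) (rep F' t p)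
    sameCosets t p =
      sameCoset (Hs-sub t) {g' = rep F' t p} (·-∈ (Hs-sub t) (F↦ t p) (inv-∈ (Hs-sub t) (F'↦ t p)))
        (·-congʳ (rep F t p · h)
          (≈-sym (inverse-unique H-sub Hh' (inverseˡ (Hs-sub t) (F'↦ t p)))))

  incident-carried : ∀ {a b r r'} → H r → Incident (Hs a) r (Hs b) r' →
                     ∃ λ h → H h × Hs a (r · h) × Hs b (r' · h)
  incident-carried {a} {b} {r} {r'} Hr inc with incident⇒≈ {g = r} {g' = r'} inc
  ... | u , v , Hs-u , Hs-v , ur≈vr' =
    inv H-sub Hur , inv-∈ H-sub Hur ,
    ∈-cancelˡ (Hs-sub a) Hs-u (∈-if-≈-id (Hs-sub a) (inverseʳ H-sub Hur)) ,
    ∈-cancelˡ (Hs-sub b) Hs-v (∈-if-≈-id (Hs-sub b)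
      (≈-trans (·-congˡ (inv H-sub Hur) (≈-sym ur≈vr')) (inverseʳ H-sub Hur)))
    where
    Hur = ·-∈ H-sub (Hs⊆H a Hs-u) Hr

  carried-triple : ∀ {i j k} → Factorises (Hs i) (Hs j) (Hs k) →
                   (F : Flag H Hs (⁅ i ⁆ ∪ ⁅ j ⁆ ∪ ⁅ k ⁆)) → ∃ λ h → H h × CarriesToBase F h
  carried-triple {i} {j} {k} factorises F
    with incident-carried {r' = rep F j ∈-triple₂} (rep∈ F i ∈-triple₁) (inc F i ∈-triple₁ j ∈-triple₂)
  ... | h₁ , Hh₁ , Fi↦ , Fj↦
    with flag-meets-subgroup F k ∈-triple₃ i ∈-triple₁ h₁ Fi↦
       | flag-meets-subgroup F k ∈-triple₃ j ∈-triple₂ h₁ Fj↦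
  ... | w , Hk-w , Hi-wq | w' , Hk-w' , Hj-w'q
    with factorises-closes-triangle (Hs-sub i) (Hs-sub j) (Hs-sub k) factorises
           Hk-w Hi-wq Hk-w' Hj-w'q
  ... | d , (Hi-d , Hj-d) , Hk-qd = h₁ · d , ·-∈ H-sub Hh₁ (Hs⊆H i Hi-d) , carries
    where
    carries : CarriesToBase F (h₁ · d)
    carries t p with ∈-triple⁻ p
    ... | inj₁ refl        = flag-same-type F t p ∈-triple₁ (h₁ · d) (·-∈ (Hs-sub t) Fi↦ Hi-d)
    ... | inj₂ (inj₁ refl) = flag-same-type F t p ∈-triple₂ (h₁ · d) (·-∈ (Hs-sub t) Fj↦ Hj-d)
    ... | inj₂ (inj₂ refl) = flag-same-type F t p ∈-triple₃ (h₁ · d) Hk-qd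

HasSize-saturates : ∀ {A : Set} {_~_ : A → A → Set} {P Q : A → Set} {c N : ℕ} →
  HasSize _~_ P c → (∀ {a a'} → a ~ a' → P a' → P a) → (∀ {a} → P a → Q a) →
  (code : ∀ {a} → Q a → Fin N) →
  (∀ {a a'} (q : Q a) (q' : Q a') → code q ≡ code q' → a ~ a') →
  N ≤ c → ∀ {a} → Q a → P a
HasSize-saturates {c = c} {N} (e , e-injective , e∈P , _) P-resp P⊆Q code code-injective N≤c Qa
  with any? (λ k → code (P⊆Q (e∈P k)) ≟ code Qa)
... | yes (k , code≡) = P-resp (code-injective Qa (P⊆Q (e∈P k)) (sym code≡)) (e∈P k)
... | no ∄k = contradiction N≤c (<⇒≱ (injective⇒≤ extended-injective))
  where
  extended : Fin (suc c) → Fin N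
  extended zero    = code Qa
  extended (suc k) = code (P⊆Q (e∈P k))

  extended-injective : ∀ {k l} → extended k ≡ extended l → k ≡ l
  extended-injective {zero}  {zero}  _  = refl
  extended-injective {zero}  {suc l} eq = contradiction (l , sym eq) ∄k
  extended-injective {suc k} {zero}  eq = contradiction (k , eq) ∄k
  extended-injective {suc k} {suc l} eq =
    cong suc (e-injective k l (code-injective (P⊆Q (e∈P k)) (P⊆Q (e∈P l)) eq))

module OrbitStabiliser {m : ℕ} {K : Perm m → Set} (K-sub : IsSubgroup K) (x : Fin m)
  {O : Fin m → Set} {a b : ℕ}
  (O⊆xK : ∀ {y} → O y → ∃ λ g → K g × g x ≡ y)
  (sizeO : HasSize _≡_ O a)
  (sizeStab : HasSize _≈_ (λ g → K g × g x ≡ x) b) where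

  orbitPoint : Fin a → Fin m
  orbitPoint = proj₁ sizeO

  stabiliser : Fin b → Perm m
  stabiliser = proj₁ sizeStab

  private
    orbitPoint-∈ : ∀ ka → ∃ λ g → K g × g x ≡ orbitPoint ka
    orbitPoint-∈ ka = O⊆xK (proj₁ (proj₂ (proj₂ sizeO)) ka)

  transversal : Fin a → Perm m
  transversal ka = proj₁ (orbitPoint-∈ ka)

  transversal-∈ : ∀ ka → K (transversal ka)
  transversal-∈ ka = proj₁ (proj₂ (orbitPoint-∈ ka))

  transversal-x : ∀ ka → transversal ka x ≡ orbitPoint ka
  transversal-x ka = proj₂ (proj₂ (orbitPoint-∈ ka))

  transversal⁻¹ : Fin a → Perm m
  transversal⁻¹ ka = inv K-sub (transversal-∈ ka)

  ·transversal⁻¹-fixes : ∀ {g} ka → K g → g x ≡ orbitPoint ka →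
                         K (g · transversal⁻¹ ka) × (g · transversal⁻¹ ka) x ≡ x
  ·transversal⁻¹-fixes {g} ka Kg gx≡ = ·-∈ K-sub Kg (inv-∈ K-sub (transversal-∈ ka)) , (begin
    transversal⁻¹ ka (g x)              ≡⟨ cong (transversal⁻¹ ka) (trans gx≡ (sym (transversal-x ka))) ⟩
    transversal⁻¹ ka (transversal ka x) ≡⟨ inverseʳ K-sub (transversal-∈ ka) x ⟩
    x                                   ∎)
    where open ≡-Reasoning

  Decomposition : Perm m → Set
  Decomposition g = ∃ λ ka → ∃ λ kb → g ≈ (stabiliser kb · transversal ka)

  decompose : ∀ {g} → K g → O (g x) → Decomposition g
  decompose {g} Kg Ogx with proj₂ (proj₂ (proj₂ sizeO)) (g x) Ogx
  ... | ka , gx≡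
    with proj₂ (proj₂ (proj₂ sizeStab)) (g · transversal⁻¹ ka) (·transversal⁻¹-fixes ka Kg gx≡)
  ... | kb , gt⁻¹≈s = ka , kb , (begin
    g                                       ≈˘⟨ ·-congʳ g (inverseˡ K-sub (transversal-∈ ka)) ⟩
    (g · transversal⁻¹ ka) · transversal ka ≈⟨ ·-congˡ (transversal ka) gt⁻¹≈s ⟩
    stabiliser kb · transversal ka          ∎)
    where open ≈-Reasoning

  index : ∀ {g} → Decomposition g → Fin (a * b)
  index (ka , kb , _) = combine ka kb

  index-injective : ∀ {g g'} (d : Decomposition g) (d' : Decomposition g') →
                    index d ≡ index d' → g ≈ g'
  index-injective (ka , kb , g≈) (ka' , kb' , g'≈) index≡
    with combine-injective ka kb ka' kb' index≡
  ... | refl , refl = ≈-trans g≈ (≈-sym g'≈)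

  code : ∀ {g} → K g × O (g x) → Fin (a * b)
  code (Kg , Ogx) = index (decompose Kg Ogx)

  code-injective : ∀ {g g'} (q : K g × O (g x)) (q' : K g' × O (g' x)) →
                   code q ≡ code q' → g ≈ g'
  code-injective (Kg , Ogx) (Kg' , Og'x) = index-injective (decompose Kg Ogx) (decompose Kg' Og'x)

All-reverse : ∀ {A : Set} {P : A → Set} {xs : List A} → All P xs → All P (reverse xs)
All-reverse {xs = []}     All.[]          = All.[]
All-reverse {P = P} {x ∷ xs} (px All.∷ pxs) =
  subst (All P) (sym (unfold-reverse x xs)) (++⁺ (All-reverse pxs) (px All.∷ All.[]))

module _ {n m : ℕ} (X : ColouredGraph n m) where
  open ColouredGraph X

  evalW-++ : ∀ w w' → evalW X (w ++ w') ≈ (evalW X w · evalW X w')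
  evalW-++ []      w' x = refl
  evalW-++ (i ∷ w) w' x = evalW-++ w w' (ρ i x)

  evalW-reverseʳ : ∀ w → (evalW X w · evalW X (reverse w)) ≈ id
  evalW-reverseʳ []      x = refl
  evalW-reverseʳ (i ∷ w) x = begin
    evalW X (reverse (i ∷ w)) (evalW X w (ρ i x))
      ≡⟨ cong (λ v → evalW X v (evalW X w (ρ i x))) (unfold-reverse i w) ⟩
    evalW X (reverse w ++ i ∷ []) (evalW X w (ρ i x))
      ≡⟨ evalW-++ (reverse w) (i ∷ []) (evalW X w (ρ i x)) ⟩
    ρ i (evalW X (reverse w) (evalW X w (ρ i x)))
      ≡⟨ cong (ρ i) (evalW-reverseʳ w (ρ i x)) ⟩
    ρ i (ρ i x)
      ≡⟨ invol i x ⟩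
    x ∎
    where open ≡-Reasoning

  evalW-reverseˡ : ∀ w → (evalW X (reverse w) · evalW X w) ≈ id
  evalW-reverseˡ w = subst (λ v → (evalW X (reverse w) · evalW X v) ≈ id)
                           (reverse-involutive w) (evalW-reverseʳ (reverse w))

  Gen-isSubgroup : (J : Subset n) → IsSubgroup (Gen X J)
  Gen-isSubgroup J = record
    { ∈-resp-≈ = λ { f≈g (w , w∈J , f≈w) → w , w∈J , ≈-trans (≈-sym f≈g) f≈w }
    ; id-∈     = [] , All.[] , ≈-refl
    ; ·-∈      = λ { {f} (w , w∈J , f≈w) (w' , w'∈J , g≈w') →
                     w ++ w' , ++⁺ w∈J w'∈J ,
                     ≈-trans (≈-trans (·-congʳ f g≈w') (·-congˡ (evalW X w') f≈w))
                             (≈-sym (evalW-++ w w')) }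
    ; inv      = λ { (w , _) → evalW X (reverse w) }
    ; inv-∈    = λ { (w , w∈J , _) → reverse w , All-reverse w∈J , ≈-refl }
    ; inverseˡ = λ { (w , _ , f≈w) → ≈-trans (·-congʳ (evalW X (reverse w)) f≈w) (evalW-reverseˡ w) }
    ; inverseʳ = λ { (w , _ , f≈w) → ≈-trans (·-congˡ (evalW X (reverse w)) f≈w) (evalW-reverseʳ w) }
    }

  Gen-mono : ∀ {J J' f} → J ⊆ J' → Gen X J f → Gen X J' f
  Gen-mono J⊆J' (w , w∈J , f≈w) = w , All.map J⊆J' w∈J , f≈w

  orbitMeet-∋ : ∀ {i j k g d e} x → G₁ X i g → G₁ X j d → G₁ X k e → g ≈ (d · e) →
                OrbitMeet X i j k x (g x)
  orbitMeet-∋ {g = g} {d} {e} x Gi-g Gj-d Gk-e g≈de =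
    (g , Gi-g , refl) , (d , e , Gj-d , Gk-e , sym (g≈de x))

  ProdInter-resp-≈ : ∀ {i j k g g'} → g ≈ g' → ProdInter X i j k g' → ProdInter X i j k g
  ProdInter-resp-≈ g≈g' (d , e , Gd , Ge , g'≈de) = d , e , Gd , Ge , ≈-trans g≈g' g'≈de

  ProdInter⊆ : ∀ {i j k g} x → ProdInter X i j k g → G₁ X i g × OrbitMeet X i j k x (g x)
  ProdInter⊆ {i} x (d , e , (Gi-d , Gj-d) , (Gi-e , Gk-e) , g≈de) =
    Gi-g , orbitMeet-∋ x Gi-g Gj-d Gk-e g≈de
    where
    Gi-g = ∈-resp-≈ (Gen-isSubgroup (∁ ⁅ i ⁆)) (≈-sym g≈de)
                    (·-∈ (Gen-isSubgroup (∁ ⁅ i ⁆)) Gi-d Gi-e)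

lemma4p4 : ∀ {n m} (X : ColouredGraph n m) →
    (∀ i → FlagTransitive (G₁ X i) (G₂ X i) (∁ ⁅ i ⁆)) →
    (i j k : Fin n) → i ≢ j → j ≢ k → i ≢ k →
    (x : Fin m) (a b c : ℕ) →
    HasSize _≡_ (OrbitMeet X i j k x) a →
    HasSize _≈_ (Stab X i x) b →
    HasSize _≈_ (ProdInter X i j k) c →
    a * b ≤ c →
    FlagTransitiveOn (G X) (G₁ X) (⁅ i ⁆ ∪ ⁅ j ⁆ ∪ ⁅ k ⁆)
lemma4p4 X _ i j k _ _ _ x a b c sizeO sizeStab sizePI ab≤c =
  flagTransitiveOn-if-carried G-sub G₁-sub G₁⊆G (carried-triple G-sub G₁-sub G₁⊆G factorises)
  where
  G-sub : IsSubgroup (G X)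
  G-sub = Gen-isSubgroup X ⊤

  G₁-sub : ∀ t → IsSubgroup (G₁ X t)
  G₁-sub t = Gen-isSubgroup X (∁ ⁅ t ⁆)

  G₁⊆G : ∀ t {f} → G₁ X t f → G X f
  G₁⊆G t = Gen-mono X (λ _ → ∈⊤)

  open OrbitStabiliser (G₁-sub i) x proj₁ sizeO sizeStab

  factorises : Factorises (G₁ X i) (G₁ X j) (G₁ X k)
  factorises Gi-g (d , e , Gj-d , Gk-e , g≈de) =
    HasSize-saturates sizePI (ProdInter-resp-≈ X) (ProdInter⊆ X x) code code-injective ab≤c
      (Gi-g , orbitMeet-∋ X x Gi-g Gj-d Gk-e g≈de)
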